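{- Let $R\le\mathbb{Q}$ be a subring such that for every integer $n\ge0$ there are only finitely many non-zero frieze patterns of height $n$ over $R$. Then $R=\mathbb{Z}$.
   Context: Let $R$ be a subset of a field. A non-zero frieze pattern of height $n\ge0$ over $R$ is a family $(c_{i,j})$, indexed by $i\in\mathbb{Z}$ and $i\le j\le n+i+3$, with $c_{i,i}=c_{i,n+i+3}=0$, $c_{i,i+1}=c_{i,n+i+2}=1$, $c_{i,j}\in R\setminus\{0\}$ for $i+2\le j\le n+i+1$, and $c_{i,j}c_{i+1,j+1}-c_{i,j+1}c_{i+1,j}=1$ for all $i\in\mathbb{Z}$ and $i+1\le j\le n+i+2$. -}

module Defs where

open import Level using (0ℓ)
open import Data.Nat as ℕ using (ℕ)
open import Data.Integer as ℤ using (ℤ; +_)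
open import Data.Rational as ℚ using (ℚ; 0ℚ; 1ℚ)
open import Data.Product using (Σ; _×_)
open import Data.List using (List)
open import Data.List.Relation.Unary.Any using (Any)
open import Relation.Binary.PropositionalEquality using (_≡_; _≢_)
open import Relation.Unary using (Pred)

record IsSubring (R : Pred ℚ 0ℓ) : Set where
  field
    zero-mem : R 0ℚ
    one-mem  : R 1ℚ
    +-mem    : ∀ {x y} → R x → R y → R (x ℚ.+ y)
    neg-mem  : ∀ {x} → R x → R (ℚ.- x)
    *-mem    : ∀ {x y} → R x → R y → R (x ℚ.* y)

-- A non-zero frieze pattern of height n over R, following the paper's
-- indexing: entries c i j for i ∈ ℤ and i ≤ j ≤ n+i+3 (the values of the
-- function c outside this range are irrelevant and ignored).
record Frieze (R : Pred ℚ 0ℓ) (n : ℕ) : Set where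
  field
    c : ℤ → ℤ → ℚ
    diag0   : ∀ i → c i i ≡ 0ℚ
    top0    : ∀ i → c i (i ℤ.+ + (n ℕ.+ 3)) ≡ 0ℚ
    diag1   : ∀ i → c i (i ℤ.+ + 1) ≡ 1ℚ
    top1    : ∀ i → c i (i ℤ.+ + (n ℕ.+ 2)) ≡ 1ℚ
    inner   : ∀ i j → i ℤ.+ + 2 ℤ.≤ j → j ℤ.≤ i ℤ.+ + (n ℕ.+ 1) →
              R (c i j) × c i j ≢ 0ℚ
    diamond : ∀ i j → i ℤ.+ + 1 ℤ.≤ j → j ℤ.≤ i ℤ.+ + (n ℕ.+ 2) →
              c i j ℚ.* c (ℤ.suc i) (ℤ.suc j)
                ℚ.- c i (ℤ.suc j) ℚ.* c (ℤ.suc i) j ≡ 1ℚ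

open Frieze public

_≈F_ : ∀ {R n} → Frieze R n → Frieze R n → Set
_≈F_ {n = n} F G = ∀ i j → i ℤ.≤ j → j ℤ.≤ i ℤ.+ + (n ℕ.+ 3) → c F i j ≡ c G i j

FinitelyManyFriezes : Pred ℚ 0ℓ → ℕ → Set
FinitelyManyFriezes R n =
  Σ (List (Frieze R n)) λ L → ∀ (F : Frieze R n) → Any (F ≈F_) L

IsIntegers : Pred ℚ 0ℓ → Set
IsIntegers R = ∀ q → (R q → Σ ℤ λ z → q ≡ z ℚ./ 1) × ((Σ ℤ λ z → q ≡ z ℚ./ 1) → R q)

-- If p/q ∈ R in lowest terms with q > 1, Bézout's identity puts 1/q in R, hence also
-- 2/q^k for every k. A frieze pattern of height 1 is determined by its quiddity row,
-- which alternates two numbers a, b with ab = 2; the pairs (q^k, 2/q^k) thus give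
-- height-one friezes over R with unbounded entry c₀₂ = q^k, whereas finitely many
-- friezes have bounded entries.
module Submission where

open import Defs
open import Level using (0ℓ)
open import Data.Empty using (⊥; ⊥-elim)
open import Data.Product using (Σ; _×_; _,_)
open import Data.Nat as ℕ using (ℕ; zero; suc; _^_; s≤s; z≤n)
import Data.Nat.Properties as ℕP
open import Data.Nat.Coprimality as Coprime using (Coprime; coprime-Bézout)
open import Data.Nat.GCD using (module Bézout)
open import Data.Nat.ListAction using (sum)
open import Data.Integer as ℤ using (ℤ; +_; -[1+_]; +≤+; 1ℤ)
import Data.Integer.Properties as ℤP
open import Data.Integer.Tactic.RingSolver using (solve-∀)
open import Data.Rational as ℚ using (ℚ; mkℚ; 0ℚ; 1ℚ; ↥_; ↧_)
open import Data.Rational.Literals using (fromℤ)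
import Data.Rational.Properties as ℚP
import Data.Rational.Unnormalised as ℚᵘ
import Data.Rational.Unnormalised.Properties as ℚᵘP
open import Data.Rational.Solver using (module +-*-Solver)
open import Data.List using (_∷_; map)
open import Data.List.Relation.Unary.Any as Any using (Any; here; there)
open import Data.List.Relation.Unary.Any.Properties using (map⁺)
open import Relation.Binary.PropositionalEquality
open import Relation.Unary using (Pred)

fromℤ-+ : ∀ a b → fromℤ (a ℤ.+ b) ≡ fromℤ a ℚ.+ fromℤ b
fromℤ-+ a b = trans (sym (ℚP.↥p/↧p≡p (fromℤ (a ℤ.+ b))))
  (ℚP./-cong (cong₂ ℤ._+_ (sym (ℤP.*-identityʳ a)) (sym (ℤP.*-identityʳ b))) refl)

fromℤ-* : ∀ a b → fromℤ (a ℤ.* b) ≡ fromℤ a ℚ.* fromℤ b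
fromℤ-* a b = sym (ℚP.↥p/↧p≡p (fromℤ (a ℤ.* b)))

fromℤ-mem : ∀ {R} → IsSubring R → ∀ z → R (fromℤ z)
fromℤ-mem {R} S (+ n)    = fromℕ-mem n
  where
  fromℕ-mem : ∀ n → R (fromℤ (+ n))
  fromℕ-mem zero    = IsSubring.zero-mem S
  fromℕ-mem (suc n) = subst R (sym (fromℤ-+ 1ℤ (+ n)))
    (IsSubring.+-mem S (IsSubring.one-mem S) (fromℕ-mem n))
fromℤ-mem S -[1+ n ] = IsSubring.neg-mem S (fromℤ-mem S (+ suc n))

p*↧p≡↥p : ∀ p → p ℚ.* fromℤ (↧ p) ≡ fromℤ (↥ p)
p*↧p≡↥p p@(mkℚ n d-1 _) = ℚP.toℚᵘ-injective
  (ℚᵘP.≃-trans (ℚP.toℚᵘ-homo-* p (fromℤ (↧ p))) (ℚᵘ.*≡* n*d*1≡n*[d*1]))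
  where
  n*d*1≡n*[d*1] : n ℤ.* + suc d-1 ℤ.* 1ℤ ≡ n ℤ.* + suc (d-1 ℕ.* 1)
  n*d*1≡n*[d*1] = trans (ℤP.*-identityʳ _) (cong (λ m → n ℤ.* + suc m) (sym (ℕP.*-identityʳ d-1)))

∣-∣-mem : ∀ {R p} → IsSubring R → R p → R ℚ.∣ p ∣
∣-∣-mem {p = mkℚ (+ _)    _ _} S r = r
∣-∣-mem {p = mkℚ -[1+ _ ] _ _} S r = IsSubring.neg-mem S r

toℤ-1+* : ∀ a b c d → a ℕ.* b ≡ 1 ℕ.+ c ℕ.* d → + a ℤ.* + b ≡ 1ℤ ℤ.+ + c ℤ.* + d
toℤ-1+* a b c d eq =
  trans (sym (ℤP.pos-* a b)) (trans (cong +_ eq) (cong (λ k → 1ℤ ℤ.+ k) (ℤP.pos-* c d)))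

coprime⇒ℤ-Bézout : ∀ {m n} → Coprime m n → Σ ℤ λ x → Σ ℤ λ y → x ℤ.* + m ℤ.+ y ℤ.* + n ≡ 1ℤ
coprime⇒ℤ-Bézout {m} {n} m⊥n with coprime-Bézout m⊥n
... | Bézout.+- x y 1+yn≡xm = + x , ℤ.- + y ,
  trans (cong (λ k → k ℤ.+ ℤ.- + y ℤ.* + n) (toℤ-1+* x m y n (sym 1+yn≡xm))) (cancelʳ (+ y) (+ n))
  where
  cancelʳ : ∀ a b → 1ℤ ℤ.+ a ℤ.* b ℤ.+ ℤ.- a ℤ.* b ≡ 1ℤ
  cancelʳ = solve-∀
... | Bézout.-+ x y 1+xm≡yn = ℤ.- + x , + y ,
  trans (cong (λ k → ℤ.- + x ℤ.* + m ℤ.+ k) (toℤ-1+* y n x m (sym 1+xm≡yn))) (cancelˡ (+ x) (+ m))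
  where
  cancelˡ : ∀ a b → ℤ.- a ℤ.* b ℤ.+ (1ℤ ℤ.+ a ℤ.* b) ≡ 1ℤ
  cancelˡ = solve-∀

bézout-inverse-mem : ∀ {R p d n x y} → IsSubring R → R p → p ℚ.* fromℤ d ≡ fromℤ n →
                     x ℤ.* n ℤ.+ y ℤ.* d ≡ 1ℤ → Σ ℚ λ u → R u × u ℚ.* fromℤ d ≡ 1ℚ
bézout-inverse-mem {p = p} {d} {n} {x} {y} S p∈R p*d≡n x*n+y*d≡1 =
  X ℚ.* p ℚ.+ Y ,
  IsSubring.+-mem S (IsSubring.*-mem S (fromℤ-mem S x) p∈R) (fromℤ-mem S y) ,
  (begin
    (X ℚ.* p ℚ.+ Y) ℚ.* D               ≡⟨ distribute X p Y D ⟩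
    X ℚ.* (p ℚ.* D) ℚ.+ Y ℚ.* D         ≡⟨ cong (λ t → X ℚ.* t ℚ.+ Y ℚ.* D) p*d≡n ⟩
    X ℚ.* fromℤ n ℚ.+ Y ℚ.* D           ≡⟨ cong₂ ℚ._+_ (fromℤ-* x n) (fromℤ-* y d) ⟨
    fromℤ (x ℤ.* n) ℚ.+ fromℤ (y ℤ.* d) ≡⟨ fromℤ-+ (x ℤ.* n) (y ℤ.* d) ⟨
    fromℤ (x ℤ.* n ℤ.+ y ℤ.* d)         ≡⟨ cong fromℤ x*n+y*d≡1 ⟩
    1ℚ                                  ∎)
  where
  open ≡-Reasoning
  open +-*-Solver
  X Y D : ℚ
  X = fromℤ x
  Y = fromℤ y
  D = fromℤ d
  distribute : ∀ a b c e → (a ℚ.* b ℚ.+ c) ℚ.* e ≡ a ℚ.* (b ℚ.* e) ℚ.+ c ℚ.* e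
  distribute = solve 4 (λ a b c e → (a :* b :+ c) :* e := a :* (b :* e) :+ c :* e) refl

denominator-inverse-mem : ∀ {R p} → IsSubring R → R p → Σ ℚ λ u → R u × u ℚ.* fromℤ (↧ p) ≡ 1ℚ
denominator-inverse-mem {p = p@(mkℚ _ _ n⊥d)} S p∈R with coprime⇒ℤ-Bézout (Coprime.recompute n⊥d)
... | x , y , bézout =
  bézout-inverse-mem {x = x} {y = y} S (∣-∣-mem S p∈R) (p*↧p≡↥p ℚ.∣ p ∣) bézout

[i+k]-i≡k : ∀ i k → i ℤ.+ k ℤ.- i ≡ k
[i+k]-i≡k = solve-∀

[1+j]-[1+i]≡j-i : ∀ i j → (1ℤ ℤ.+ j) ℤ.- (1ℤ ℤ.+ i) ≡ j ℤ.- i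
[1+j]-[1+i]≡j-i = solve-∀

[1+j]-i≡1+[j-i] : ∀ i j → (1ℤ ℤ.+ j) ℤ.- i ≡ 1ℤ ℤ.+ (j ℤ.- i)
[1+j]-i≡1+[j-i] = solve-∀

j-[1+i]≡-1+[j-i] : ∀ i j → j ℤ.- (1ℤ ℤ.+ i) ≡ ℤ.-1ℤ ℤ.+ (j ℤ.- i)
j-[1+i]≡-1+[j-i] = solve-∀

i+k≤j⇒k≤j-i : ∀ i j k → i ℤ.+ k ℤ.≤ j → k ℤ.≤ j ℤ.- i
i+k≤j⇒k≤j-i i j k i+k≤j = subst (ℤ._≤ j ℤ.- i) ([i+k]-i≡k i k) (ℤP.+-monoˡ-≤ (ℤ.- i) i+k≤j)

j≤i+k⇒j-i≤k : ∀ i j k → j ℤ.≤ i ℤ.+ k → j ℤ.- i ℤ.≤ k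
j≤i+k⇒j-i≤k i j k j≤i+k = subst (j ℤ.- i ℤ.≤_) ([i+k]-i≡k i k) (ℤP.+-monoˡ-≤ (ℤ.- i) j≤i+k)

alternateℕ : ℚ → ℚ → ℕ → ℚ
alternateℕ x y zero    = x
alternateℕ x y (suc n) = alternateℕ y x n

alternate : ℚ → ℚ → ℤ → ℚ
alternate x y (+ n)    = alternateℕ x y n
alternate x y -[1+ n ] = alternateℕ y x n

alternate-suc : ∀ x y i → alternate x y (ℤ.suc i) ≡ alternate y x i
alternate-suc x y (+ n)        = refl
alternate-suc x y -[1+ zero ]  = refl
alternate-suc x y -[1+ suc n ] = refl

alternate-pair : ∀ (P : ℚ → ℚ → Set) {x y} → P x y → P y x →
                 ∀ i → P (alternate x y i) (alternate y x i)
alternate-pair P Pxy Pyx (+ n)    = alternateℕ-pair Pxy Pyx n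
  where
  alternateℕ-pair : ∀ {x y} → P x y → P y x → ∀ n → P (alternateℕ x y n) (alternateℕ y x n)
  alternateℕ-pair Pxy Pyx zero    = Pxy
  alternateℕ-pair Pxy Pyx (suc n) = alternateℕ-pair Pyx Pxy n
alternate-pair P Pxy Pyx -[1+ n ] = alternate-pair P Pyx Pxy (+ n)

two : ℚ
two = fromℤ (+ 2)

-- c i j of a height-one frieze as a function of j - i and of the quiddity entry
-- c i (i + 2); the catch-all 0 is right for j - i ∈ {0, 4} and never used otherwise.
heightOneEntry : ℤ → ℚ → ℚ
heightOneEntry (+ 1) _ = 1ℚ
heightOneEntry (+ 2) a = a
heightOneEntry (+ 3) _ = 1ℚ
heightOneEntry _     _ = 0ℚ

heightOneEntry-diamond : ∀ e {a b} → + 1 ℤ.≤ e → e ℤ.≤ + 3 → a ℚ.* b ≡ two →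
  heightOneEntry e a ℚ.* heightOneEntry e b
    ℚ.- heightOneEntry (ℤ.suc e) a ℚ.* heightOneEntry (ℤ.pred e) b ≡ 1ℚ
heightOneEntry-diamond (+ 1) {a}     _ _ _    = cong (λ t → 1ℚ ℚ.- t) (ℚP.*-zeroʳ a)
heightOneEntry-diamond (+ 2)         _ _ ab≡2 = cong (ℚ._- 1ℚ) ab≡2
heightOneEntry-diamond (+ 3) {b = b} _ _ _    = cong (λ t → 1ℚ ℚ.- t) (ℚP.*-zeroˡ b)
heightOneEntry-diamond (+ 0) (+≤+ ()) _ _
heightOneEntry-diamond (+ suc (suc (suc (suc _)))) _ (+≤+ (s≤s (s≤s (s≤s ())))) _
heightOneEntry-diamond -[1+ _ ] () _ _

heightOneFrieze : ∀ {R a b} → R a → R b → a ℚ.* b ≡ two → Frieze R 1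
heightOneFrieze {R} {a} {b} a∈R b∈R a*b≡2 = record
  { c       = λ i j → heightOneEntry (j ℤ.- i) (quiddity i)
  ; diag0   = λ i → cong (λ e → heightOneEntry e (quiddity i)) (ℤP.+-inverseʳ i)
  ; top0    = λ i → cong (λ e → heightOneEntry e (quiddity i)) ([i+k]-i≡k i (+ 4))
  ; diag1   = λ i → cong (λ e → heightOneEntry e (quiddity i)) ([i+k]-i≡k i (+ 1))
  ; top1    = λ i → cong (λ e → heightOneEntry e (quiddity i)) ([i+k]-i≡k i (+ 3))
  ; inner   = λ i j i+2≤j j≤i+2 →
      subst (λ e → R (heightOneEntry e (quiddity i)) × heightOneEntry e (quiddity i) ≢ 0ℚ)
        (sym (ℤP.≤-antisym (j≤i+k⇒j-i≤k i j (+ 2) j≤i+2) (i+k≤j⇒k≤j-i i j (+ 2) i+2≤j)))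
        (quiddity-mem i)
  ; diamond = entry-diamond
  }
  where
  quiddity : ℤ → ℚ
  quiddity = alternate a b

  b*a≡2 : b ℚ.* a ≡ two
  b*a≡2 = trans (ℚP.*-comm b a) a*b≡2

  factor≢0 : ∀ {x y} → x ℚ.* y ≡ two → x ≢ 0ℚ
  factor≢0 {y = y} x*y≡2 refl with trans (sym (ℚP.*-zeroˡ y)) x*y≡2
  ... | ()

  quiddity-mem : ∀ i → R (quiddity i) × quiddity i ≢ 0ℚ
  quiddity-mem =
    alternate-pair (λ u _ → R u × u ≢ 0ℚ) (a∈R , factor≢0 a*b≡2) (b∈R , factor≢0 b*a≡2)

  quiddity-product : ∀ i → quiddity i ℚ.* quiddity (ℤ.suc i) ≡ two
  quiddity-product i rewrite alternate-suc a b i =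
    alternate-pair (λ u v → u ℚ.* v ≡ two) a*b≡2 b*a≡2 i

  entry-diamond : ∀ i j → i ℤ.+ + 1 ℤ.≤ j → j ℤ.≤ i ℤ.+ + 3 →
    heightOneEntry (j ℤ.- i) (quiddity i)
      ℚ.* heightOneEntry (ℤ.suc j ℤ.- ℤ.suc i) (quiddity (ℤ.suc i))
    ℚ.- heightOneEntry (ℤ.suc j ℤ.- i) (quiddity i)
      ℚ.* heightOneEntry (j ℤ.- ℤ.suc i) (quiddity (ℤ.suc i))
    ≡ 1ℚ
  entry-diamond i j i+1≤j j≤i+3
    rewrite [1+j]-[1+i]≡j-i i j | [1+j]-i≡1+[j-i] i j | j-[1+i]≡-1+[j-i] i j =
    heightOneEntry-diamond (j ℤ.- i) (i+k≤j⇒k≤j-i i j (+ 1) i+1≤j) (j≤i+k⇒j-i≤k i j (+ 3) j≤i+3)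
      (quiddity-product i)

inverse-powers-divide : ∀ {R u d t} → IsSubring R → R u → u ℚ.* fromℤ (+ d) ≡ 1ℚ → R t →
  ∀ k → Σ ℚ λ b → R b × fromℤ (+ (d ^ k)) ℚ.* b ≡ t
inverse-powers-divide {t = t} S u∈R u*d≡1 t∈R zero = t , t∈R , ℚP.*-identityˡ t
inverse-powers-divide {u = u} {d} {t} S u∈R u*d≡1 t∈R (suc k)
  with inverse-powers-divide S u∈R u*d≡1 t∈R k
... | b , b∈R , dᵏ*b≡t = u ℚ.* b , IsSubring.*-mem S u∈R b∈R , (begin
    fromℤ (+ (d ℕ.* d ^ k)) ℚ.* (u ℚ.* b)   ≡⟨ cong (ℚ._* (u ℚ.* b)) dᵏ⁺¹≡d*dᵏ ⟩
    (D ℚ.* Dᵏ) ℚ.* (u ℚ.* b)                ≡⟨ interchange D Dᵏ u b ⟩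
    (u ℚ.* D) ℚ.* (Dᵏ ℚ.* b)                ≡⟨ cong₂ ℚ._*_ u*d≡1 dᵏ*b≡t ⟩
    1ℚ ℚ.* t                                ≡⟨ ℚP.*-identityˡ t ⟩
    t                                       ∎)
  where
  open ≡-Reasoning
  open +-*-Solver
  D Dᵏ : ℚ
  D = fromℤ (+ d)
  Dᵏ = fromℤ (+ (d ^ k))
  dᵏ⁺¹≡d*dᵏ : fromℤ (+ (d ℕ.* d ^ k)) ≡ D ℚ.* Dᵏ
  dᵏ⁺¹≡d*dᵏ = trans (cong fromℤ (ℤP.pos-* d (d ^ k))) (fromℤ-* (+ d) (+ (d ^ k)))
  interchange : ∀ a b c e → (a ℚ.* b) ℚ.* (c ℚ.* e) ≡ (c ℚ.* a) ℚ.* (b ℚ.* e)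
  interchange = solve 4 (λ a b c e → (a :* b) :* (c :* e) := (c :* a) :* (b :* e)) refl

≤-sum : ∀ {m ns} → Any (m ℕ.≤_) ns → m ℕ.≤ sum ns
≤-sum (here m≤n)              = ℕP.≤-trans m≤n (ℕP.m≤m+n _ _)
≤-sum {ns = n ∷ _} (there m≤) = ℕP.≤-trans (≤-sum m≤) (ℕP.m≤n+m _ n)

finitelyMany⇒entry-bounded : ∀ {R n} i j → i ℤ.≤ j → j ℤ.≤ i ℤ.+ + (n ℕ.+ 3) →
  FinitelyManyFriezes R n → Σ ℕ λ B → ∀ F → ℤ.∣ ↥ c F i j ∣ ℕ.≤ B
finitelyMany⇒entry-bounded {R} {n} i j i≤j j≤i+n+3 (L , covers) =
  sum (map size L) , λ F → ≤-sum (map⁺ (Any.map (λ {G} → size-≤ {F} {G}) (covers F)))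
  where
  size : Frieze R n → ℕ
  size G = ℤ.∣ ↥ c G i j ∣
  size-≤ : ∀ {F G} → F ≈F G → size F ℕ.≤ size G
  size-≤ F≈G = ℕP.≤-reflexive (cong (λ q → ℤ.∣ ↥ q ∣) (F≈G i j i≤j j≤i+n+3))

n<m^n : ∀ {m} → 1 ℕ.< m → ∀ n → n ℕ.< m ^ n
n<m^n     1<m zero    = s≤s z≤n
n<m^n {m} 1<m (suc n) = ℕP.≤-<-trans (n<m^n 1<m n) (ℕP.^-monoʳ-< m 1<m (ℕP.n<1+n n))

integer>1-not-invertible : ∀ {R u d} → IsSubring R → FinitelyManyFriezes R 1 →
  R u → u ℚ.* fromℤ (+ d) ≡ 1ℚ → 1 ℕ.< d → ⊥
integer>1-not-invertible {d = d} S finite u∈R u*d≡1 1<d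
  with finitelyMany⇒entry-bounded (+ 0) (+ 2) (+≤+ z≤n) (+≤+ (s≤s (s≤s z≤n))) finite
... | B , bounded with inverse-powers-divide S u∈R u*d≡1 (fromℤ-mem S (+ 2)) B
... | b , b∈R , dᴮ*b≡2 =
  ℕP.<⇒≱ (n<m^n 1<d B) (bounded (heightOneFrieze (fromℤ-mem S (+ (d ^ B))) b∈R dᴮ*b≡2))

denominator>1-impossible : ∀ {R q} → IsSubring R → FinitelyManyFriezes R 1 → R q → 1 ℕ.< ℚ.↧ₙ q → ⊥
denominator>1-impossible {q = q} S finite q∈R 1<↧q with denominator-inverse-mem S q∈R
... | u , u∈R , u*↧q≡1 = integer>1-not-invertible {d = ℚ.↧ₙ q} S finite u∈R u*↧q≡1 1<↧q

corollary3p10 : (R : Pred ℚ 0ℓ) → IsSubring R →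
    (∀ (n : ℕ) → FinitelyManyFriezes R n) → IsIntegers R
corollary3p10 R S finite q = integral q , λ (z , q≡z/1) →
  subst R (sym (trans q≡z/1 (ℚP.↥p/↧p≡p (fromℤ z)))) (fromℤ-mem S z)
  where
  integral : ∀ q → R q → Σ ℤ λ z → q ≡ z ℚ./ 1
  integral q@(mkℚ n zero _) _    = n , sym (ℚP.↥p/↧p≡p q)
  integral (mkℚ _ (suc _) _) q∈R =
    ⊥-elim (denominator>1-impossible S (finite 1) q∈R (s≤s (s≤s z≤n)))
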